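{- Let $s \in \Sigma^*$ with $|s| \ge 1$ and $\mathcal{F}(s) = [\tau_0, \ldots, \tau_{k-1}]$. Then $\tau_0 = (\texttt{@\$}, 1)$ (a non-terminal token with split position $1$), and any terminal token (one with split position $0$) in $\mathcal{F}(s)$ can only be the last element $\tau_{k-1}$.
   Context: Let $\Sigma$ be an alphabet and let $\texttt{@}$ and $\texttt{\$}$ be two distinct symbols not in $\Sigma$. For $s \in \Sigma^*$ let $\hat{s} = \texttt{@}\, s\, \texttt{\$}$. The leading run of a non-empty string is its longest prefix consisting of a single repeated symbol; the trailing run is its longest suffix consisting of a single repeated symbol. A bilateral token is a pair $(\sigma,p)$ with $\sigma$ a non-empty string and $p \in \mathbb{N}_0$; it is terminal if $p = 0$. The Flashback decomposition $\mathcal{F}(s)$ is produced as follows, starting with active span $\hat{s}$: (i) if the active span is empty, stop; (ii) let $\ell$ be the length of its leading run; if $\ell$ equals the length of the span, append (span, $0$) and stop; (iii) otherwise let $\sigma$ be the leading run followed by the trailing run, and let the middle be the span with its leading and trailing runs removed; if the middle is empty append $(\sigma,0)$ and stop, otherwise append $(\sigma,\ell)$ and continue with the middle as the new active span. Here $\texttt{@\$}$ denotes the two-character string. -}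

module Defs where

open import Data.Nat using (ℕ; zero; suc; _∸_; _≡ᵇ_)
open import Data.List using (List; []; _∷_; _++_; length; take; drop; reverse)
open import Data.Product using (_×_; _,_)
open import Data.Bool using (Bool; true; false; if_then_else_)
open import Relation.Nullary using (yes; no)
open import Relation.Binary.PropositionalEquality using (refl)
open import Relation.Binary.Definitions using (DecidableEquality)

-- Symbols of Σ extended with the two fresh sentinels @ and $.
data Ext (A : Set) : Set where
  at     : Ext A
  dollar : Ext A
  sym    : A → Ext A

hat : {A : Set} → List A → List (Ext A)
hat s = at ∷ (Data.List.map sym s ++ dollar ∷ [])

-- A bilateral token (σ , p); terminal iff p = 0.
Token : Set → Set
Token A = List (Ext A) × ℕ

module _ {A : Set} (_≟_ : DecidableEquality A) where

  _≟E_ : DecidableEquality (Ext A)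
  at ≟E at = yes refl
  at ≟E dollar = no (λ ())
  at ≟E sym _ = no (λ ())
  dollar ≟E at = no (λ ())
  dollar ≟E dollar = yes refl
  dollar ≟E sym _ = no (λ ())
  sym _ ≟E at = no (λ ())
  sym _ ≟E dollar = no (λ ())
  sym a ≟E sym b with a ≟ b
  ... | yes refl = yes refl
  ... | no ne = no (λ { refl → ne refl })

  countLead : Ext A → List (Ext A) → ℕ
  countLead x [] = zero
  countLead x (y ∷ ys) with x ≟E y
  ... | yes _ = suc (countLead x ys)
  ... | no _  = zero

  leadLen : List (Ext A) → ℕ
  leadLen [] = zero
  leadLen (x ∷ xs) = suc (countLead x xs)

  trailLen : List (Ext A) → ℕ
  trailLen xs = leadLen (reverse xs)

  -- One step of the decomposition, with fuel (fuel ≥ length of span suffices,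
  -- since the active span strictly shrinks).
  flashbackFuel : ℕ → List (Ext A) → List (Token A)
  flashbackFuel zero _ = []
  flashbackFuel (suc f) [] = []
  flashbackFuel (suc f) span@(_ ∷ _) =
    let n = length span
        l = leadLen span
        t = trailLen span
        lead = take l span
        trail = drop (n ∸ t) span
        σ = lead ++ trail
        middle = drop l (take (n ∸ t) span)
    in if l ≡ᵇ n then (span , 0) ∷ []
       else (case-middle middle σ l)
    where
    case-middle : List (Ext A) → List (Ext A) → ℕ → List (Token A)
    case-middle [] σ l = (σ , 0) ∷ []
    case-middle m@(_ ∷ _) σ l = (σ , l) ∷ flashbackFuel f m

  flashback : List A → List (Token A)
  flashback s = flashbackFuel (length (hat s)) (hat s)

{-# OPTIONS --safe #-}
-- The active span ŝ = @ s $ begins with the one-symbol run @ (s is non-empty, and @ ∉ Σ) and ends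
-- with the one-symbol run $, so the first step emits (@$, 1) and leaves the middle s. A token that
-- is not emitted as the last step carries the length of the leading run of a non-empty span, which
-- is positive, so only the last token can be terminal.
module Submission where

open import Defs
open import Data.Nat using (ℕ; suc; zero; _≥_; _∸_; _≡ᵇ_)
open import Data.List using (List; []; _∷_; _∷ʳ_; length; lookup; take; drop; reverse; map)
open import Data.List.Properties using (reverse-++; unfold-reverse; reverse-map)
open import Data.Fin using (Fin; toℕ) renaming (zero to fzero; suc to fsuc)
open import Data.Product using (Σ; _×_; _,_; proj₂)
open import Data.Bool using (true; false)
open import Relation.Binary.PropositionalEquality using (_≡_; refl; cong; module ≡-Reasoning)
open import Relation.Binary.Definitions using (DecidableEquality)

module _ {A : Set} where

  take-length-∷ʳ : (x y : A) (xs : List A) → take (length (xs ∷ʳ y)) (x ∷ xs ∷ʳ y) ≡ x ∷ xs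
  take-length-∷ʳ x y []       = refl
  take-length-∷ʳ x y (z ∷ xs) = cong (x ∷_) (take-length-∷ʳ z y xs)

  drop-length-∷ʳ : (x y : A) (xs : List A) → drop (length (xs ∷ʳ y)) (x ∷ xs ∷ʳ y) ≡ y ∷ []
  drop-length-∷ʳ x y []       = refl
  drop-length-∷ʳ x y (z ∷ xs) = drop-length-∷ʳ z y xs

  OnlyLastTerminal : List (Token A) → Set
  OnlyLastTerminal τs = (i : Fin (length τs)) → proj₂ (lookup τs i) ≡ 0 → toℕ i ≡ length τs ∸ 1

  onlyLastTerminal-[] : OnlyLastTerminal []
  onlyLastTerminal-[] ()

  onlyLastTerminal-[_] : (τ : Token A) → OnlyLastTerminal (τ ∷ [])
  onlyLastTerminal-[ τ ] fzero _ = refl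

  onlyLastTerminal-∷ : (σ : List (Ext A)) (p : ℕ) {τs : List (Token A)} →
                       OnlyLastTerminal τs → OnlyLastTerminal ((σ , suc p) ∷ τs)
  onlyLastTerminal-∷ σ p              onlyLast fzero    ()
  onlyLastTerminal-∷ σ p {τs = _ ∷ _} onlyLast (fsuc i) terminal = cong suc (onlyLast i terminal)

module _ {A : Set} (_≟_ : DecidableEquality A) where

  flashbackFuel-onlyLastTerminal : (fuel : ℕ) (span : List (Ext A)) →
                                   OnlyLastTerminal (flashbackFuel _≟_ fuel span)
  flashbackFuel-onlyLastTerminal zero       _        = onlyLastTerminal-[]
  flashbackFuel-onlyLastTerminal (suc fuel) []       = onlyLastTerminal-[]
  flashbackFuel-onlyLastTerminal (suc fuel) (x ∷ xs)
    -- the two tests of a step: is the span a single run, and is its middle empty?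
    with countLead _≟_ x xs ≡ᵇ length xs
       | drop (suc (countLead _≟_ x xs)) (take (suc (length xs) ∸ trailLen _≟_ (x ∷ xs)) (x ∷ xs))
  ... | true  | _      = onlyLastTerminal-[ _ ]
  ... | false | []     = onlyLastTerminal-[ _ ]
  ... | false | m ∷ ms = onlyLastTerminal-∷ _ _ (flashbackFuel-onlyLastTerminal fuel (m ∷ ms))

  countLead-dollar-map-sym-∷ʳ-at : (r : List A) → countLead _≟_ dollar (map sym r ∷ʳ at) ≡ 0
  countLead-dollar-map-sym-∷ʳ-at []      = refl
  countLead-dollar-map-sym-∷ʳ-at (_ ∷ _) = refl

  reverse-hat : (s : List A) → reverse (hat s) ≡ dollar ∷ map sym (reverse s) ∷ʳ at
  reverse-hat s = begin
    reverse ((at ∷ map sym s) ∷ʳ dollar)    ≡⟨ reverse-++ (at ∷ map sym s) (dollar ∷ []) ⟩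
    dollar ∷ reverse (at ∷ map sym s)       ≡⟨ cong (dollar ∷_) (unfold-reverse at (map sym s)) ⟩
    dollar ∷ reverse (map sym s) ∷ʳ at      ≡⟨ cong (λ r → dollar ∷ r ∷ʳ at) (reverse-map sym s) ⟨
    dollar ∷ map sym (reverse s) ∷ʳ at      ∎
    where open ≡-Reasoning

  trailLen-hat : (s : List A) → trailLen _≟_ (hat s) ≡ 1
  trailLen-hat s = begin
    leadLen _≟_ (reverse (hat s))                          ≡⟨ cong (leadLen _≟_) (reverse-hat s) ⟩
    suc (countLead _≟_ dollar (map sym (reverse s) ∷ʳ at)) ≡⟨ cong suc (countLead-dollar-map-sym-∷ʳ-at (reverse s)) ⟩
    1                                                      ∎
    where open ≡-Reasoning

  flashback-∷ : (a : A) (s : List A) →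
                flashback _≟_ (a ∷ s)
                  ≡ (at ∷ dollar ∷ [] , 1) ∷ flashbackFuel _≟_ (length (map sym (a ∷ s) ∷ʳ dollar)) (map sym (a ∷ s))
  flashback-∷ a s
    rewrite trailLen-hat (a ∷ s)
          | take-length-∷ʳ (sym a) dollar (map sym s)
          | drop-length-∷ʳ (sym a) dollar (map sym s) = refl

mainTheorem5 : {A : Set} (_≟_ : DecidableEquality A) (s : List A) → length s ≥ 1 →
    (Σ (List (Token A)) λ rest → flashback _≟_ s ≡ (at ∷ dollar ∷ [] , 1) ∷ rest)
    × ((i : Fin (length (flashback _≟_ s))) →
         proj₂ (lookup (flashback _≟_ s) i) ≡ 0 →
         toℕ i ≡ length (flashback _≟_ s) ∸ 1)
mainTheorem5 _≟_ s@(a ∷ s′) _ =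
  (_ , flashback-∷ _≟_ a s′) , flashbackFuel-onlyLastTerminal _≟_ (length (hat s)) (hat s)
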